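{- Let $r\ge 2$. For every $\varepsilon>0$ there exists $\delta>0$ such that if $\mathcal{F}$ is an $r$-graph, $u\in V(\mathcal{F})$, $\mu\in\mathcal{M}(\mathcal{F})$, $\lambda(\mathcal{F},\mu)\geq\lambda(\mathcal{F})-\delta$ and $\mu(u)\geq\varepsilon$, then $\lambda(\mathcal{F},\mu,u)\geq r\lambda(\mathcal{F})-\varepsilon$.
   Context: $\mathcal{M}(\mathcal{F})$ is the set of probability distributions on $V(\mathcal{F})$. $\lambda(\mathcal{F},\mu)=\sum_{F\in\mathcal{F}}\prod_{v\in F}\mu(v)$, $\lambda(\mathcal{F})=\max_{\mu\in\mathcal{M}(\mathcal{F})}\lambda(\mathcal{F},\mu)$ (the Lagrangian), and $\lambda(\mathcal{F},\mu,u)=\sum_{I\in L_{\mathcal{F}}(u)}\prod_{v\in I}\mu(v)$, where $L_{\mathcal{F}}(u)=\{I:|I|=r-1,\ I\cup\{u\}\in\mathcal{F}\}$.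
   Formalization: The parameters ε and δ are taken rational, μ is a rational-valued distribution, and $\lambda(\mathcal{F})$ is taken as the supremum of $\lambda(\mathcal{F},\mu)$ over rational-valued distributions. -}

module Defs where

open import Data.Nat using (ℕ)
open import Data.Fin using (Fin; _≟_)
open import Data.Fin.Subset using (Subset; ∣_∣; inside; outside)
open import Data.Vec using (lookup)
open import Data.List using (List; []; _∷_)
open import Data.List.Relation.Unary.All using (All)
open import Data.List.Relation.Unary.Unique.Propositional using (Unique)
open import Data.Integer using (+_)
open import Data.Rational using (ℚ; 0ℚ; 1ℚ; _+_; _*_; _≤_; _/_)
open import Data.Product using (_×_)
open import Relation.Binary.PropositionalEquality using (_≡_)
open import Relation.Nullary using (yes; no)

sumFin : (n : ℕ) → (Fin n → ℚ) → ℚ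
sumFin ℕ.zero f = 0ℚ
sumFin (ℕ.suc n) f = f Fin.zero + sumFin n (λ i → f (Fin.suc i))

prodFin : (n : ℕ) → (Fin n → ℚ) → ℚ
prodFin ℕ.zero f = 1ℚ
prodFin (ℕ.suc n) f = f Fin.zero * prodFin n (λ i → f (Fin.suc i))

ℕ→ℚ : ℕ → ℚ
ℕ→ℚ k = (+ k) / 1

IsRGraph : (r : ℕ) {n : ℕ} → List (Subset n) → Set
IsRGraph r {n} F = Unique F × All (λ e → ∣ e ∣ ≡ r) F

IsDist : {n : ℕ} → (Fin n → ℚ) → Set
IsDist {n} μ = ((i : Fin n) → 0ℚ ≤ μ i) × sumFin n μ ≡ 1ℚ

edgeWeight : {n : ℕ} → (Fin n → ℚ) → Subset n → ℚ
edgeWeight {n} μ e = prodFin n (λ v → w (lookup e v) v)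
  where
  w : _ → Fin n → ℚ
  w inside v = μ v
  w outside v = 1ℚ

-- λ(F, μ) = Σ_{e ∈ F} ∏_{v ∈ e} μ(v)
lag : {n : ℕ} → List (Subset n) → (Fin n → ℚ) → ℚ
lag [] μ = 0ℚ
lag (e ∷ F) μ = edgeWeight μ e + lag F μ

linkWeight : {n : ℕ} → (Fin n → ℚ) → Fin n → Subset n → ℚ
linkWeight {n} μ u e = prodFin n (λ v → w (lookup e v) v)
  where
  w : _ → Fin n → ℚ
  w outside v = 1ℚ
  w inside v with v ≟ u
  ... | yes _ = 1ℚ
  ... | no _ = μ v

-- λ(F, μ, u) = Σ_{I ∈ L_F(u)} ∏_{v ∈ I} μ(v)
--            = Σ_{e ∈ F, u ∈ e} ∏_{v ∈ e \ {u}} μ(v)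
lagLink : {n : ℕ} → List (Subset n) → (Fin n → ℚ) → Fin n → ℚ
lagLink [] μ u = 0ℚ
lagLink (e ∷ F) μ u with lookup e u
... | inside = linkWeight μ u e + lagLink F μ u
... | outside = lagLink F μ u

-- Move mass t from u and rescale: ν = c (μ − t 1ᵤ) with c (1 − t) = 1 is again a distribution.
-- Since λ(F, ·) is affine in the u-coordinate with slope λ(F, μ, u) and homogeneous of degree r,
-- λ(F, ν) = cʳ (λ(F, μ) − t λ(F, μ, u)), and cʳ ≥ (1 + t)ʳ ≥ 1 + rt by Bernoulli.  Near-optimality
-- of μ therefore gives (1 + rt)(λ(F, μ) − t λ(F, μ, u)) ≤ λ(F, μ) + δ, that is, roughly
-- λ(F, μ, u) ≥ r λ(F, μ) − δ/t − r²t, because λ(F, μ) ≤ (Σ μ)ʳ = 1 for a hypergraph without repeated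
-- edges.  As every distribution ν′ has λ(F, ν′) ≤ λ(F, μ) + δ, taking t ≈ ε/r² and δ ≈ tε proves the
-- claim; the hypothesis μ(u) ≥ ε only serves to make t ≤ μ(u).
module Submission where

open import Defs
open import Data.Nat using (ℕ; _≤_)
open import Data.Fin using (Fin)
open import Data.Fin.Subset using (Subset)
open import Data.List using (List)
open import Data.Rational using (ℚ; 0ℚ; _<_; _*_; _-_) renaming (_≤_ to _≤ℚ_)
open import Data.Product using (∃-syntax; _×_)

open import Algebra.Bundles using (CommutativeRing)
import Algebra.Properties.CommutativeSemigroup as CommutativeSemigroupProperties
open import Data.Bool using (if_then_else_)
open import Data.Empty using (⊥-elim)
open import Data.Fin using (zero; suc)
open import Data.Fin.Properties using () renaming (_≟_ to _≟ᶠ_)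
open import Data.Fin.Subset using (inside; outside; ∣_∣)
import Data.Integer as ℤ
import Data.Integer.Properties as ℤ
open import Data.List using ([]; _∷_)
open import Data.List.Relation.Unary.All using (All; []; _∷_)
open import Data.List.Relation.Unary.AllPairs using ([]; _∷_)
open import Data.List.Relation.Unary.Unique.Propositional using (Unique)
open import Data.Nat using (zero; suc)
import Data.Nat.Coprimality as Coprimality
import Data.Nat.Properties as ℕ
open import Data.Product using (Σ-syntax; _,_; proj₁)
open import Data.Rational using (1ℚ; ½; _+_; -_; 1/_; _/_; _⊓_; Positive; NonZero; positive; nonNegative)
open import Data.Rational.Properties
  using ( +-*-commutativeRing; _≟_; _<?_; module ≤-Reasoning
        ; ≤-refl; ≤-reflexive; ≤-trans; <⇒≤; ≤-<-trans; ⊓-sel; p⊓q≤p; p⊓q≤q; neg-antimono-≤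
        ; +-assoc; +-identityˡ; +-identityʳ; +-inverseʳ; *-assoc; *-identityˡ; *-identityʳ
        ; *-zeroˡ; *-zeroʳ; *-distribˡ-+; *-distribʳ-+; *-inverseˡ
        ; +-mono-≤; +-monoˡ-≤; +-monoʳ-≤; +-monoˡ-<; +-mono-<-≤
        ; *-monoˡ-≤-nonNeg; *-monoʳ-≤-nonNeg; *-cancelˡ-≤-pos
        ; positive⁻¹; nonNegative⁻¹; nonNeg*nonNeg⇒nonNeg; pos*pos⇒pos; pos⇒nonZero; 1/pos⇒pos
        ; normalize-coprime )
open import Data.Sum using ([_,_]′)
open import Data.Vec using (lookup; []; _∷_)
open import Data.Vec.Functional using (updateAt)
open import Data.Vec.Functional.Properties using (updateAt-updates; updateAt-minimal)
open import Function using (id; const)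
open import Level using (0ℓ)
open import Relation.Binary.PropositionalEquality
open import Relation.Nullary using (yes; no)
open import Relation.Nullary.Decidable using (dec⇒maybe; from-yes)
import Tactic.RingSolver as RingSolver
import Tactic.RingSolver.Core.AlmostCommutativeRing as ACR

open CommutativeRing +-*-commutativeRing using (commutativeSemiring; *-commutativeSemigroup)
open import Algebra.Properties.CommutativeSemiring.Exp commutativeSemiring using (_^_)

private
  module *-Comm = CommutativeSemigroupProperties *-commutativeSemigroup

ℚ-ring : ACR.AlmostCommutativeRing 0ℓ 0ℓ
ℚ-ring = ACR.fromCommutativeRing +-*-commutativeRing (λ p → dec⇒maybe (0ℚ ≟ p))

0≤1 : 0ℚ ≤ℚ 1ℚ
0≤1 = <⇒≤ (positive⁻¹ 1ℚ)

0<½ : 0ℚ < ½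
0<½ = positive⁻¹ ½

½<1 : ½ * 1ℚ < 1ℚ
½<1 = from-yes (½ * 1ℚ <? 1ℚ)

+-nonNeg : ∀ {p q} → 0ℚ ≤ℚ p → 0ℚ ≤ℚ q → 0ℚ ≤ℚ p + q
+-nonNeg = +-mono-≤

*-nonNeg : ∀ {p q} → 0ℚ ≤ℚ p → 0ℚ ≤ℚ q → 0ℚ ≤ℚ p * q
*-nonNeg {p} {q} 0≤p 0≤q =
  nonNegative⁻¹ _ {{nonNeg*nonNeg⇒nonNeg p {{nonNegative 0≤p}} q {{nonNegative 0≤q}}}}

*-pos : ∀ {p q} → 0ℚ < p → 0ℚ < q → 0ℚ < p * q
*-pos {p} {q} 0<p 0<q = positive⁻¹ _ {{pos*pos⇒pos p {{positive 0<p}} q {{positive 0<q}}}}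

0≤1+p : ∀ {p} → 0ℚ ≤ℚ p → 0ℚ ≤ℚ 1ℚ + p
0≤1+p = +-nonNeg 0≤1

0<1+p : ∀ {p} → 0ℚ ≤ℚ p → 0ℚ < 1ℚ + p
0<1+p = +-mono-<-≤ (positive⁻¹ 1ℚ)

*-monoˡ-≤-0≤ : ∀ {r p q} → 0ℚ ≤ℚ r → p ≤ℚ q → r * p ≤ℚ r * q
*-monoˡ-≤-0≤ {r} 0≤r = *-monoˡ-≤-nonNeg r {{nonNegative 0≤r}}

*-monoʳ-≤-0≤ : ∀ {r p q} → 0ℚ ≤ℚ r → p ≤ℚ q → p * r ≤ℚ q * r
*-monoʳ-≤-0≤ {r} 0≤r = *-monoʳ-≤-nonNeg r {{nonNegative 0≤r}}

*-cancelˡ-≤-0< : ∀ {r p q} → 0ℚ < r → r * p ≤ℚ r * q → p ≤ℚ q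
*-cancelˡ-≤-0< {r} 0<r = *-cancelˡ-≤-pos r {{positive 0<r}}

p≤p+q : ∀ {p q} → 0ℚ ≤ℚ q → p ≤ℚ p + q
p≤p+q {p} {q} 0≤q = subst (_≤ℚ p + q) (+-identityʳ p) (+-monoʳ-≤ p 0≤q)

q≤p+q : ∀ {p q} → 0ℚ ≤ℚ p → q ≤ℚ p + q
q≤p+q {p} {q} 0≤p = subst (_≤ℚ p + q) (+-identityˡ q) (+-monoˡ-≤ q 0≤p)

p≤q⇒0≤q-p : ∀ {p q} → p ≤ℚ q → 0ℚ ≤ℚ q - p
p≤q⇒0≤q-p {p} {q} p≤q = subst (_≤ℚ q - p) (+-inverseʳ p) (+-monoˡ-≤ (- p) p≤q)

p<q⇒0<q-p : ∀ {p q} → p < q → 0ℚ < q - p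
p<q⇒0<q-p {p} {q} p<q = subst (_< q - p) (+-inverseʳ p) (+-monoˡ-< (- p) p<q)

0≤q-p⇒p≤q : ∀ {p q} → 0ℚ ≤ℚ q - p → p ≤ℚ q
0≤q-p⇒p≤q {p} {q} 0≤q-p = subst (p ≤ℚ_) (cancel p q) (q≤p+q 0≤q-p)
  where
  cancel : ∀ p q → q - p + p ≡ q
  cancel = RingSolver.solve-∀ ℚ-ring

p-r≤q⇒p≤q+r : ∀ {p q r} → p - r ≤ℚ q → p ≤ℚ q + r
p-r≤q⇒p≤q+r {p} {q} {r} p-r≤q = subst (_≤ℚ q + r) (cancel p r) (+-monoˡ-≤ r p-r≤q)
  where
  cancel : ∀ p r → p - r + r ≡ p
  cancel = RingSolver.solve-∀ ℚ-ring

record PositiveQuotient (b a : ℚ) : Set where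
  field
    quotient     : ℚ
    0<quotient   : 0ℚ < quotient
    quotient*a≡b : quotient * a ≡ b

positive-quotient : ∀ {a b} → 0ℚ < a → 0ℚ < b → PositiveQuotient b a
positive-quotient {a} {b} 0<a 0<b = record
  { quotient     = b * 1/ a
  ; 0<quotient   = *-pos 0<b (positive⁻¹ (1/ a) {{1/pos⇒pos a}})
  ; quotient*a≡b = trans (*-assoc b (1/ a) a) (trans (cong (b *_) (*-inverseˡ a)) (*-identityʳ b))
  }
  where
  instance
    a-positive : Positive a
    a-positive = positive 0<a
    a-nonZero : NonZero a
    a-nonZero = pos⇒nonZero a

ℕ→ℚ-suc : ∀ k → ℕ→ℚ (suc k) ≡ 1ℚ + ℕ→ℚ k
ℕ→ℚ-suc k rewrite normalize-coprime (Coprimality.sym (Coprimality.1-coprimeTo k)) =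
  cong (λ z → (ℤ.+ 1 ℤ.+ z) / 1) (sym (trans (ℤ.+◃n≡+n _) (cong ℤ.+_ (ℕ.*-identityʳ k))))

ℕ→ℚ-nonNeg : ∀ k → 0ℚ ≤ℚ ℕ→ℚ k
ℕ→ℚ-nonNeg zero    = ≤-refl
ℕ→ℚ-nonNeg (suc k) = subst (0ℚ ≤ℚ_) (sym (ℕ→ℚ-suc k)) (0≤1+p (ℕ→ℚ-nonNeg k))

^-zeroˡ : ∀ n → 1ℚ ^ n ≡ 1ℚ
^-zeroˡ zero    = refl
^-zeroˡ (suc n) = trans (*-identityˡ (1ℚ ^ n)) (^-zeroˡ n)

^-nonNeg : ∀ {p} n → 0ℚ ≤ℚ p → 0ℚ ≤ℚ p ^ n
^-nonNeg zero    0≤p = 0≤1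
^-nonNeg (suc n) 0≤p = *-nonNeg 0≤p (^-nonNeg n 0≤p)

^-mono-≤ : ∀ {p q} n → 0ℚ ≤ℚ p → p ≤ℚ q → p ^ n ≤ℚ q ^ n
^-mono-≤         zero    0≤p p≤q = ≤-refl
^-mono-≤ {p} {q} (suc n) 0≤p p≤q = begin
  p * p ^ n ≤⟨ *-monoʳ-≤-0≤ (^-nonNeg n 0≤p) p≤q ⟩
  q * p ^ n ≤⟨ *-monoˡ-≤-0≤ (≤-trans 0≤p p≤q) (^-mono-≤ n 0≤p p≤q) ⟩
  q * q ^ n ∎
  where open ≤-Reasoning

bernoulli : ∀ n {h} → 0ℚ ≤ℚ h → 1ℚ + ℕ→ℚ n * h ≤ℚ (1ℚ + h) ^ n
bernoulli zero    {h} 0≤h = ≤-reflexive (trans (cong (1ℚ +_) (*-zeroˡ h)) (+-identityʳ 1ℚ))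
bernoulli (suc n) {h} 0≤h = begin
  1ℚ + ℕ→ℚ (suc n) * h           ≡⟨ cong (λ k → 1ℚ + k * h) (ℕ→ℚ-suc n) ⟩
  1ℚ + (1ℚ + N) * h              ≤⟨ p≤p+q (*-nonNeg (*-nonNeg (ℕ→ℚ-nonNeg n) 0≤h) 0≤h) ⟩
  1ℚ + (1ℚ + N) * h + N * h * h  ≡⟨ expand N h ⟩
  (1ℚ + h) * (1ℚ + N * h)        ≤⟨ *-monoˡ-≤-0≤ (0≤1+p 0≤h) (bernoulli n 0≤h) ⟩
  (1ℚ + h) * (1ℚ + h) ^ n        ∎
  where
  open ≤-Reasoning
  N : ℚ
  N = ℕ→ℚ n
  expand : ∀ N h → 1ℚ + (1ℚ + N) * h + N * h * h ≡ (1ℚ + h) * (1ℚ + N * h)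
  expand = RingSolver.solve-∀ ℚ-ring

prodFin-cong : ∀ n {f g : Fin n → ℚ} → (∀ v → f v ≡ g v) → prodFin n f ≡ prodFin n g
prodFin-cong zero    f≗g = refl
prodFin-cong (suc n) f≗g = cong₂ _*_ (f≗g zero) (prodFin-cong n (λ v → f≗g (suc v)))

weight : ∀ {n} → (Fin n → ℚ) → Subset n → ℚ
weight {n} μ e = prodFin n (λ v → if lookup e v then μ v else 1ℚ)

weight-nonNeg : ∀ {n} {μ : Fin n → ℚ} → (∀ v → 0ℚ ≤ℚ μ v) → ∀ e → 0ℚ ≤ℚ weight μ e
weight-nonNeg {zero}  μ≥0 []            = 0≤1
weight-nonNeg {suc n} μ≥0 (inside  ∷ e) = *-nonNeg (μ≥0 zero) (weight-nonNeg (λ v → μ≥0 (suc v)) e)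
weight-nonNeg {suc n} μ≥0 (outside ∷ e) = *-nonNeg 0≤1 (weight-nonNeg (λ v → μ≥0 (suc v)) e)

weight-scale : ∀ {n} (c : ℚ) (μ : Fin n → ℚ) e → weight (λ v → c * μ v) e ≡ c ^ ∣ e ∣ * weight μ e
weight-scale {zero}  c μ []            = refl
weight-scale {suc n} c μ (inside  ∷ e) = begin
  c * μ zero * weight (λ v → c * μ (suc v)) e  ≡⟨ cong (c * μ zero *_) (weight-scale c μ′ e) ⟩
  c * μ zero * (c ^ ∣ e ∣ * weight μ′ e)       ≡⟨ *-Comm.interchange c (μ zero) (c ^ ∣ e ∣) _ ⟩
  c * c ^ ∣ e ∣ * (μ zero * weight μ′ e)       ∎
  where
  open ≡-Reasoning
  μ′ : Fin n → ℚ
  μ′ v = μ (suc v)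
weight-scale {suc n} c μ (outside ∷ e) = begin
  1ℚ * weight (λ v → c * μ (suc v)) e  ≡⟨ cong (1ℚ *_) (weight-scale c μ′ e) ⟩
  1ℚ * (c ^ ∣ e ∣ * weight μ′ e)       ≡⟨ *-Comm.x∙yz≈y∙xz 1ℚ (c ^ ∣ e ∣) (weight μ′ e) ⟩
  c ^ ∣ e ∣ * (1ℚ * weight μ′ e)       ∎
  where
  open ≡-Reasoning
  μ′ : Fin n → ℚ
  μ′ v = μ (suc v)

weight-cong : ∀ {n} {μ ν : Fin n → ℚ} e → (∀ v → lookup e v ≡ inside → μ v ≡ ν v) → weight μ e ≡ weight ν e
weight-cong {n} {μ} {ν} e μ≗ν = prodFin-cong n factor-cong
  where
  factor-cong : ∀ v → (if lookup e v then μ v else 1ℚ) ≡ (if lookup e v then ν v else 1ℚ)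
  factor-cong v with lookup e v in v∈e
  ... | inside  = μ≗ν v v∈e
  ... | outside = refl

weight-split : ∀ {n} (μ : Fin n → ℚ) {u} e → lookup e u ≡ inside →
               weight μ e ≡ μ u * weight (updateAt μ u (const 1ℚ)) e
weight-split {suc n} μ {zero}  (inside ∷ e) refl = cong (μ zero *_) (sym (*-identityˡ _))
weight-split {suc n} μ {suc u} (b ∷ e)      u∈e  = begin
  s * weight μ′ e                                   ≡⟨ cong (s *_) (weight-split μ′ e u∈e) ⟩
  s * (μ′ u * weight (updateAt μ′ u (const 1ℚ)) e)  ≡⟨ *-Comm.x∙yz≈y∙xz s (μ′ u) _ ⟩
  μ′ u * (s * weight (updateAt μ′ u (const 1ℚ)) e)  ∎
  where
  open ≡-Reasoning
  μ′ : Fin n → ℚ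
  μ′ v = μ (suc v)
  s : ℚ
  s = if b then μ zero else 1ℚ

-- Defs defines the factors of edgeWeight and linkWeight by where-bound functions, which cannot be
-- named here; these Σ-types let unification name them.
private
  edgeFactors : ∀ {n} (μ : Fin n → ℚ) e → Σ[ f ∈ (Fin n → ℚ) ] edgeWeight μ e ≡ prodFin n f
  edgeFactors μ e = _ , refl

  edgeFactor : ∀ {n} (μ : Fin n → ℚ) e v → proj₁ (edgeFactors μ e) v ≡ (if lookup e v then μ v else 1ℚ)
  edgeFactor μ e v with lookup e v
  ... | inside  = refl
  ... | outside = refl

  linkFactors : ∀ {n} (μ : Fin n → ℚ) u e → Σ[ f ∈ (Fin n → ℚ) ] linkWeight μ u e ≡ prodFin n f
  linkFactors μ u e = _ , refl

  linkFactor : ∀ {n} (μ : Fin n → ℚ) u e v →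
               proj₁ (linkFactors μ u e) v ≡ (if lookup e v then updateAt μ u (const 1ℚ) v else 1ℚ)
  linkFactor μ u e v with lookup e v
  ... | outside = refl
  ... | inside with v ≟ᶠ u
  ...   | yes refl = sym (updateAt-updates u μ)
  ...   | no v≢u   = sym (updateAt-minimal v u μ v≢u)

edgeWeight≡weight : ∀ {n} (μ : Fin n → ℚ) e → edgeWeight μ e ≡ weight μ e
edgeWeight≡weight {n} μ e = prodFin-cong n (edgeFactor μ e)

linkWeight≡weight : ∀ {n} (μ : Fin n → ℚ) u e → linkWeight μ u e ≡ weight (updateAt μ u (const 1ℚ)) e
linkWeight≡weight {n} μ u e = prodFin-cong n (linkFactor μ u e)

edgeWeight-cons : ∀ {n} (μ : Fin (suc n) → ℚ) b e →
                  edgeWeight μ (b ∷ e) ≡ (if b then μ zero else 1ℚ) * edgeWeight (λ v → μ (suc v)) e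
edgeWeight-cons μ b e = trans (edgeWeight≡weight μ (b ∷ e))
  (cong ((if b then μ zero else 1ℚ) *_) (sym (edgeWeight≡weight (λ v → μ (suc v)) e)))

edgeWeight-split : ∀ {n} (μ : Fin n → ℚ) {u} e → lookup e u ≡ inside →
                   edgeWeight μ e ≡ μ u * linkWeight μ u e
edgeWeight-split μ {u} e u∈e = begin
  edgeWeight μ e                            ≡⟨ edgeWeight≡weight μ e ⟩
  weight μ e                                ≡⟨ weight-split μ e u∈e ⟩
  μ u * weight (updateAt μ u (const 1ℚ)) e  ≡⟨ cong (μ u *_) (linkWeight≡weight μ u e) ⟨
  μ u * linkWeight μ u e                    ∎
  where open ≡-Reasoning

EqualExcept : ∀ {n} → Fin n → (Fin n → ℚ) → (Fin n → ℚ) → Set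
EqualExcept u μ ν = ∀ v → v ≢ u → μ v ≡ ν v

edgeWeight-outside : ∀ {n} {μ ν : Fin n → ℚ} {u} e → EqualExcept u μ ν → lookup e u ≡ outside →
                     edgeWeight μ e ≡ edgeWeight ν e
edgeWeight-outside {μ = μ} {ν} {u} e μ≈ν u∉e = begin
  edgeWeight μ e  ≡⟨ edgeWeight≡weight μ e ⟩
  weight μ e      ≡⟨ weight-cong e (λ v v∈e → μ≈ν v (λ { refl → inside≢outside (trans (sym v∈e) u∉e) })) ⟩
  weight ν e      ≡⟨ edgeWeight≡weight ν e ⟨
  edgeWeight ν e  ∎
  where
  open ≡-Reasoning
  inside≢outside : inside ≢ outside
  inside≢outside ()

linkWeight-cong : ∀ {n} {μ ν : Fin n → ℚ} {u} e → EqualExcept u μ ν → linkWeight μ u e ≡ linkWeight ν u e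
linkWeight-cong {μ = μ} {ν} {u} e μ≈ν = begin
  linkWeight μ u e                    ≡⟨ linkWeight≡weight μ u e ⟩
  weight (updateAt μ u (const 1ℚ)) e  ≡⟨ weight-cong e (λ v _ → updates-agree v) ⟩
  weight (updateAt ν u (const 1ℚ)) e  ≡⟨ linkWeight≡weight ν u e ⟨
  linkWeight ν u e                    ∎
  where
  open ≡-Reasoning
  updates-agree : ∀ v → updateAt μ u (const 1ℚ) v ≡ updateAt ν u (const 1ℚ) v
  updates-agree v with v ≟ᶠ u
  ... | yes refl = trans (updateAt-updates u μ) (sym (updateAt-updates u ν))
  ... | no v≢u   = trans (updateAt-minimal v u μ v≢u) (trans (μ≈ν v v≢u) (sym (updateAt-minimal v u ν v≢u)))

-- The Lagrangian

sumFin-nonNeg : ∀ n {μ : Fin n → ℚ} → (∀ v → 0ℚ ≤ℚ μ v) → 0ℚ ≤ℚ sumFin n μ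
sumFin-nonNeg zero    μ≥0 = ≤-refl
sumFin-nonNeg (suc n) μ≥0 = +-nonNeg (μ≥0 zero) (sumFin-nonNeg n (λ v → μ≥0 (suc v)))

sumFin-scale : ∀ n (c : ℚ) (μ : Fin n → ℚ) → sumFin n (λ v → c * μ v) ≡ c * sumFin n μ
sumFin-scale zero    c μ = sym (*-zeroʳ c)
sumFin-scale (suc n) c μ =
  trans (cong (c * μ zero +_) (sumFin-scale n c (λ v → μ (suc v)))) (sym (*-distribˡ-+ c (μ zero) _))

sumFin-updateAt : ∀ {n} (μ : Fin n → ℚ) u (f : ℚ → ℚ) →
                  sumFin n (updateAt μ u f) ≡ sumFin n μ + (f (μ u) - μ u)
sumFin-updateAt {suc n} μ zero    f = regroup (μ zero) (f (μ zero)) (sumFin n (λ v → μ (suc v)))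
  where
  regroup : ∀ a b s → b + s ≡ a + s + (b - a)
  regroup = RingSolver.solve-∀ ℚ-ring
sumFin-updateAt {suc n} μ (suc u) f =
  trans (cong (μ zero +_) (sumFin-updateAt (λ v → μ (suc v)) u f)) (sym (+-assoc (μ zero) _ _))

lag-nonNeg : ∀ {n} (F : List (Subset n)) {μ : Fin n → ℚ} → (∀ v → 0ℚ ≤ℚ μ v) → 0ℚ ≤ℚ lag F μ
lag-nonNeg []          μ≥0 = ≤-refl
lag-nonNeg (e ∷ F) {μ} μ≥0 =
  +-nonNeg (subst (0ℚ ≤ℚ_) (sym (edgeWeight≡weight μ e)) (weight-nonNeg μ≥0 e)) (lag-nonNeg F μ≥0)

lag-scale : ∀ {n r} (F : List (Subset n)) (c : ℚ) (μ : Fin n → ℚ) → All (λ e → ∣ e ∣ ≡ r) F →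
            lag F (λ v → c * μ v) ≡ c ^ r * lag F μ
lag-scale {r = r} []      c μ []                = sym (*-zeroʳ (c ^ r))
lag-scale {r = r} (e ∷ F) c μ (∣e∣≡r ∷ uniform) = begin
  edgeWeight (λ v → c * μ v) e + lag F (λ v → c * μ v)  ≡⟨ cong₂ _+_ edge (lag-scale F c μ uniform) ⟩
  c ^ r * edgeWeight μ e + c ^ r * lag F μ              ≡⟨ *-distribˡ-+ (c ^ r) _ _ ⟨
  c ^ r * (edgeWeight μ e + lag F μ)                    ∎
  where
  open ≡-Reasoning
  edge : edgeWeight (λ v → c * μ v) e ≡ c ^ r * edgeWeight μ e
  edge = begin
    edgeWeight (λ v → c * μ v) e  ≡⟨ edgeWeight≡weight _ e ⟩
    weight (λ v → c * μ v) e      ≡⟨ weight-scale c μ e ⟩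
    c ^ ∣ e ∣ * weight μ e        ≡⟨ cong₂ (λ k w → c ^ k * w) (sym ∣e∣≡r) (edgeWeight≡weight μ e) ⟨
    c ^ r * edgeWeight μ e        ∎

lag-affine : ∀ {n} (F : List (Subset n)) {μ ν : Fin n → ℚ} {u} → EqualExcept u μ ν →
             lag F ν ≡ lag F μ + (ν u - μ u) * lagLink F μ u
lag-affine []      {μ} {ν} {u} μ≈ν = sym (cong (0ℚ +_) (*-zeroʳ (ν u - μ u)))
lag-affine (e ∷ F) {μ} {ν} {u} μ≈ν with lookup e u in u∈e
... | inside  = begin
  edgeWeight ν e + lag F ν                          ≡⟨ cong₂ _+_ edge (lag-affine F μ≈ν) ⟩
  ν u * l + (lag F μ + (ν u - μ u) * L)             ≡⟨ regroup (μ u) (ν u) l (lag F μ) L ⟩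
  μ u * l + lag F μ + (ν u - μ u) * (l + L)         ≡⟨ cong (λ w → w + lag F μ + (ν u - μ u) * (l + L)) split ⟨
  edgeWeight μ e + lag F μ + (ν u - μ u) * (l + L)  ∎
  where
  open ≡-Reasoning
  l L : ℚ
  l = linkWeight μ u e
  L = lagLink F μ u
  split : edgeWeight μ e ≡ μ u * l
  split = edgeWeight-split μ e u∈e
  edge : edgeWeight ν e ≡ ν u * l
  edge = trans (edgeWeight-split ν e u∈e) (cong (ν u *_) (linkWeight-cong e (λ v v≢u → sym (μ≈ν v v≢u))))
  regroup : ∀ a b l Λ L → b * l + (Λ + (b - a) * L) ≡ a * l + Λ + (b - a) * (l + L)
  regroup = RingSolver.solve-∀ ℚ-ring
... | outside = begin
  edgeWeight ν e + lag F ν                                  ≡⟨ cong₂ _+_ edge (lag-affine F μ≈ν) ⟩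
  edgeWeight μ e + (lag F μ + (ν u - μ u) * lagLink F μ u)  ≡⟨ +-assoc (edgeWeight μ e) (lag F μ) _ ⟨
  edgeWeight μ e + lag F μ + (ν u - μ u) * lagLink F μ u    ∎
  where
  open ≡-Reasoning
  edge : edgeWeight ν e ≡ edgeWeight μ e
  edge = sym (edgeWeight-outside e μ≈ν u∈e)

link₀ delete₀ : ∀ {n} → List (Subset (suc n)) → List (Subset n)
link₀ []                    = []
link₀ ((inside  ∷ e) ∷ F)   = e ∷ link₀ F
link₀ ((outside ∷ e) ∷ F)   = link₀ F
delete₀ []                  = []
delete₀ ((inside  ∷ e) ∷ F) = delete₀ F
delete₀ ((outside ∷ e) ∷ F) = e ∷ delete₀ F

module _ {n} {P : Subset (suc n) → Set} {Q : Subset n → Set} where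

  All-link₀ : (∀ {e} → P (inside ∷ e) → Q e) → ∀ {F} → All P F → All Q (link₀ F)
  All-link₀ P⇒Q {[]}                []       = []
  All-link₀ P⇒Q {(inside  ∷ e) ∷ F} (p ∷ ps) = P⇒Q p ∷ All-link₀ P⇒Q ps
  All-link₀ P⇒Q {(outside ∷ e) ∷ F} (p ∷ ps) = All-link₀ P⇒Q ps

  All-delete₀ : (∀ {e} → P (outside ∷ e) → Q e) → ∀ {F} → All P F → All Q (delete₀ F)
  All-delete₀ P⇒Q {[]}                []       = []
  All-delete₀ P⇒Q {(inside  ∷ e) ∷ F} (p ∷ ps) = All-delete₀ P⇒Q ps
  All-delete₀ P⇒Q {(outside ∷ e) ∷ F} (p ∷ ps) = P⇒Q p ∷ All-delete₀ P⇒Q ps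

Unique-link₀ : ∀ {n} {F : List (Subset (suc n))} → Unique F → Unique (link₀ F)
Unique-link₀ {F = []}                []         = []
Unique-link₀ {F = (inside  ∷ e) ∷ F} (e∉F ∷ F!) =
  All-link₀ (λ e≢ e≡ → e≢ (cong (inside ∷_) e≡)) e∉F ∷ Unique-link₀ F!
Unique-link₀ {F = (outside ∷ e) ∷ F} (e∉F ∷ F!) = Unique-link₀ F!

Unique-delete₀ : ∀ {n} {F : List (Subset (suc n))} → Unique F → Unique (delete₀ F)
Unique-delete₀ {F = []}                []         = []
Unique-delete₀ {F = (inside  ∷ e) ∷ F} (e∉F ∷ F!) = Unique-delete₀ F!
Unique-delete₀ {F = (outside ∷ e) ∷ F} (e∉F ∷ F!) =
  All-delete₀ (λ e≢ e≡ → e≢ (cong (outside ∷_) e≡)) e∉F ∷ Unique-delete₀ F!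

link₀-empty : ∀ {n} (F : List (Subset (suc n))) → All (λ e → ∣ e ∣ ≡ 0) F → link₀ F ≡ []
link₀-empty []                  []       = refl
link₀-empty ((outside ∷ e) ∷ F) (_ ∷ ps) = link₀-empty F ps

lag-split₀ : ∀ {n} (F : List (Subset (suc n))) (μ : Fin (suc n) → ℚ) →
             lag F μ ≡ μ zero * lag (link₀ F) (λ v → μ (suc v)) + lag (delete₀ F) (λ v → μ (suc v))
lag-split₀ []                      μ = sym (cong (_+ 0ℚ) (*-zeroʳ (μ zero)))
lag-split₀ {n} ((inside  ∷ e) ∷ F) μ =
  trans (cong₂ _+_ (edgeWeight-cons μ inside e) (lag-split₀ F μ))
        (regroup (μ zero) (edgeWeight μ′ e) (lag (link₀ F) μ′) (lag (delete₀ F) μ′))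
  where
  μ′ : Fin n → ℚ
  μ′ v = μ (suc v)
  regroup : ∀ a w x y → a * w + (a * x + y) ≡ a * (w + x) + y
  regroup = RingSolver.solve-∀ ℚ-ring
lag-split₀ {n} ((outside ∷ e) ∷ F) μ =
  trans (cong₂ _+_ (edgeWeight-cons μ outside e) (lag-split₀ F μ))
        (regroup (μ zero) (edgeWeight μ′ e) (lag (link₀ F) μ′) (lag (delete₀ F) μ′))
  where
  μ′ : Fin n → ℚ
  μ′ v = μ (suc v)
  regroup : ∀ a w x y → 1ℚ * w + (a * x + y) ≡ a * x + (w + y)
  regroup = RingSolver.solve-∀ ℚ-ring

lag≤sum^r : ∀ {n} r (F : List (Subset n)) {μ : Fin n → ℚ} → Unique F → All (λ e → ∣ e ∣ ≡ r) F →
            (∀ v → 0ℚ ≤ℚ μ v) → lag F μ ≤ℚ sumFin n μ ^ r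
lag≤sum^r {zero}  r []            _               _           _ = ^-nonNeg r ≤-refl
lag≤sum^r {zero}  r ([] ∷ [])     _               (refl ∷ []) _ = ≤-refl
lag≤sum^r {zero}  r ([] ∷ [] ∷ F) ((≢[] ∷ _) ∷ _) _           _ = ⊥-elim (≢[] refl)
lag≤sum^r {suc n} zero F {μ} F! uniform μ≥0 = begin
  lag F μ                                         ≡⟨ lag-split₀ F μ ⟩
  μ zero * lag (link₀ F) μ′ + lag (delete₀ F) μ′  ≡⟨ cong (λ G → μ zero * lag G μ′ + D) (link₀-empty F uniform) ⟩
  μ zero * 0ℚ + D                                 ≡⟨ cong (_+ D) (*-zeroʳ (μ zero)) ⟩
  0ℚ + D                                          ≡⟨ +-identityˡ D ⟩
  D                                               ≤⟨ delete-bound ⟩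
  1ℚ                                              ∎
  where
  open ≤-Reasoning
  μ′ : Fin n → ℚ
  μ′ v = μ (suc v)
  D : ℚ
  D = lag (delete₀ F) μ′
  delete-bound : D ≤ℚ 1ℚ
  delete-bound =
    lag≤sum^r zero (delete₀ F) (Unique-delete₀ F!) (All-delete₀ id uniform) (λ v → μ≥0 (suc v))
lag≤sum^r {suc n} (suc r) F {μ} F! uniform μ≥0 = begin
  lag F μ                                         ≡⟨ lag-split₀ F μ ⟩
  μ zero * lag (link₀ F) μ′ + lag (delete₀ F) μ′  ≤⟨ +-mono-≤ (*-monoˡ-≤-0≤ (μ≥0 zero) link-bound) delete-bound ⟩
  μ zero * s ^ r + s * s ^ r                      ≡⟨ *-distribʳ-+ (s ^ r) (μ zero) s ⟨
  (μ zero + s) * s ^ r                            ≤⟨ *-monoˡ-≤-0≤ (+-nonNeg (μ≥0 zero) 0≤s) s^r≤sum^r ⟩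
  (μ zero + s) * (μ zero + s) ^ r                 ∎
  where
  open ≤-Reasoning
  μ′ : Fin n → ℚ
  μ′ v = μ (suc v)
  s : ℚ
  s = sumFin n μ′
  0≤s : 0ℚ ≤ℚ s
  0≤s = sumFin-nonNeg n (λ v → μ≥0 (suc v))
  s^r≤sum^r : s ^ r ≤ℚ (μ zero + s) ^ r
  s^r≤sum^r = ^-mono-≤ r 0≤s (q≤p+q (μ≥0 zero))
  link-bound : lag (link₀ F) μ′ ≤ℚ s ^ r
  link-bound =
    lag≤sum^r r (link₀ F) (Unique-link₀ F!) (All-link₀ ℕ.suc-injective uniform) (λ v → μ≥0 (suc v))
  delete-bound : lag (delete₀ F) μ′ ≤ℚ s ^ suc r
  delete-bound =
    lag≤sum^r (suc r) (delete₀ F) (Unique-delete₀ F!) (All-delete₀ id uniform) (λ v → μ≥0 (suc v))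

-- Moving mass away from u

perturbation-bound : ∀ {n r} (F : List (Subset n)) → All (λ e → ∣ e ∣ ≡ r) F →
  (u : Fin n) (μ : Fin n → ℚ) → IsDist μ →
  ∀ {δ} → ((ν : Fin n → ℚ) → IsDist ν → lag F ν - δ ≤ℚ lag F μ) →
  ∀ {t} → 0ℚ ≤ℚ t → t < 1ℚ → t ≤ℚ μ u →
  (1ℚ + ℕ→ℚ r * t) * (lag F μ - t * lagLink F μ u) ≤ℚ lag F μ + δ
perturbation-bound {n} {r} F uniform u μ (μ≥0 , Σμ≡1) {δ} near-optimal {t} 0≤t t<1 t≤μu = begin
  (1ℚ + ℕ→ℚ r * t) * Λ̃  ≤⟨ *-monoʳ-≤-0≤ 0≤Λ̃ (≤-trans (bernoulli r 0≤t) (^-mono-≤ r (0≤1+p 0≤t) 1+t≤c)) ⟩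
  c ^ r * Λ̃             ≡⟨ lag-ν ⟨
  lag F ν               ≤⟨ p-r≤q⇒p≤q+r (near-optimal ν ν-dist) ⟩
  lag F μ + δ           ∎
  where
  open ≤-Reasoning
  open PositiveQuotient (positive-quotient (p<q⇒0<q-p t<1) (positive⁻¹ 1ℚ))
    renaming (quotient to c; 0<quotient to 0<c; quotient*a≡b to c[1-t]≡1)

  Λ̃ : ℚ
  Λ̃ = lag F μ - t * lagLink F μ u
  μ̃ ν : Fin n → ℚ
  μ̃ = updateAt μ u (_- t)
  ν v = c * μ̃ v

  μ̃≥0 : ∀ v → 0ℚ ≤ℚ μ̃ v
  μ̃≥0 v with v ≟ᶠ u
  ... | yes refl = subst (0ℚ ≤ℚ_) (sym (updateAt-updates u μ)) (p≤q⇒0≤q-p t≤μu)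
  ... | no v≢u   = subst (0ℚ ≤ℚ_) (sym (updateAt-minimal v u μ v≢u)) (μ≥0 v)

  lag-μ̃ : lag F μ̃ ≡ Λ̃
  lag-μ̃ = begin-equality
    lag F μ̃                           ≡⟨ lag-affine F (λ v v≢u → sym (updateAt-minimal v u μ v≢u)) ⟩
    lag F μ + (μ̃ u - μ u) * L         ≡⟨ cong (λ x → lag F μ + (x - μ u) * L) (updateAt-updates u μ) ⟩
    lag F μ + (μ u - t - μ u) * L     ≡⟨ simplify (lag F μ) (μ u) t L ⟩
    Λ̃                                 ∎
    where
    L : ℚ
    L = lagLink F μ u
    simplify : ∀ Λ a t L → Λ + (a - t - a) * L ≡ Λ - t * L
    simplify = RingSolver.solve-∀ ℚ-ring

  0≤Λ̃ : 0ℚ ≤ℚ Λ̃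
  0≤Λ̃ = subst (0ℚ ≤ℚ_) lag-μ̃ (lag-nonNeg F μ̃≥0)

  lag-ν : lag F ν ≡ c ^ r * Λ̃
  lag-ν = trans (lag-scale F c μ̃ uniform) (cong (c ^ r *_) lag-μ̃)

  ν-dist : IsDist ν
  ν-dist = (λ v → *-nonNeg (<⇒≤ 0<c) (μ̃≥0 v)) , (begin-equality
    sumFin n ν                          ≡⟨ sumFin-scale n c μ̃ ⟩
    c * sumFin n μ̃                      ≡⟨ cong (c *_) (sumFin-updateAt μ u (_- t)) ⟩
    c * (sumFin n μ + (μ u - t - μ u))  ≡⟨ cong (λ s → c * (s + (μ u - t - μ u))) Σμ≡1 ⟩
    c * (1ℚ + (μ u - t - μ u))          ≡⟨ cong (c *_) (simplify (μ u) t) ⟩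
    c * (1ℚ - t)                        ≡⟨ c[1-t]≡1 ⟩
    1ℚ                                  ∎)
    where
    simplify : ∀ a t → 1ℚ + (a - t - a) ≡ 1ℚ - t
    simplify = RingSolver.solve-∀ ℚ-ring

  1+t≤c : 1ℚ + t ≤ℚ c
  1+t≤c = begin
    1ℚ + t                               ≤⟨ p≤p+q (*-nonNeg (*-nonNeg (<⇒≤ 0<c) 0≤t) 0≤t) ⟩
    1ℚ + t + c * t * t                   ≡⟨ cong (_+ c * t * t) (*-identityˡ (1ℚ + t)) ⟨
    1ℚ * (1ℚ + t) + c * t * t            ≡⟨ cong (λ x → x * (1ℚ + t) + c * t * t) c[1-t]≡1 ⟨
    c * (1ℚ - t) * (1ℚ + t) + c * t * t  ≡⟨ simplify c t ⟩
    c                                    ∎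
    where
    simplify : ∀ c t → c * (1ℚ - t) * (1ℚ + t) + c * t * t ≡ c
    simplify = RingSolver.solve-∀ ℚ-ring

link-lower-bound : ∀ {R t δ ε Λ L X} → 0ℚ ≤ℚ R → 0ℚ < t → 0ℚ ≤ℚ ε → Λ ≤ℚ 1ℚ →
  (1ℚ + R * t) * (Λ - t * L) ≤ℚ Λ + δ → X ≤ℚ Λ + δ →
  R * R * t ≤ℚ ½ * ε → δ * (1ℚ + t * R * (1ℚ + R * t)) ≤ℚ ½ * (t * ε) →
  R * X - ε ≤ℚ L
link-lower-bound {R} {t} {δ} {ε} {Λ} {L} {X} 0≤R 0<t 0≤ε Λ≤1 perturbed X≤Λ+δ R²t≤ε/2 δ-small =
  *-cancelˡ-≤-0< (*-pos 0<t (0<1+p 0≤Rt))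
    (0≤q-p⇒p≤q (subst (0ℚ ≤ℚ_) (sym (certificate R t δ ε Λ L X)) slack≥0))
  where
  0≤t : 0ℚ ≤ℚ t
  0≤t = <⇒≤ 0<t
  0≤Rt : 0ℚ ≤ℚ R * t
  0≤Rt = *-nonNeg 0≤R 0≤t
  certificate : ∀ R t δ ε Λ L X →
    t * (1ℚ + R * t) * L - t * (1ℚ + R * t) * (R * X - ε)
      ≡ ((Λ + δ) - (1ℚ + R * t) * (Λ - t * L))
        + t * R * (1ℚ + R * t) * ((Λ + δ) - X)
        + (½ * (t * ε) - δ * (1ℚ + t * R * (1ℚ + R * t)))
        + t * (½ * ε - R * R * t)
        + R * R * t * t * (1ℚ - Λ)
        + R * t * t * ε
  certificate = RingSolver.solve-∀ ℚ-ring
  slack≥0 : 0ℚ ≤ℚ ((Λ + δ) - (1ℚ + R * t) * (Λ - t * L))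
                  + t * R * (1ℚ + R * t) * ((Λ + δ) - X)
                  + (½ * (t * ε) - δ * (1ℚ + t * R * (1ℚ + R * t)))
                  + t * (½ * ε - R * R * t)
                  + R * R * t * t * (1ℚ - Λ)
                  + R * t * t * ε
  slack≥0 =
    +-nonNeg (+-nonNeg (+-nonNeg (+-nonNeg (+-nonNeg
      (p≤q⇒0≤q-p perturbed)
      (*-nonNeg (*-nonNeg (*-nonNeg 0≤t 0≤R) (0≤1+p 0≤Rt)) (p≤q⇒0≤q-p X≤Λ+δ)))
      (p≤q⇒0≤q-p δ-small))
      (*-nonNeg 0≤t (p≤q⇒0≤q-p R²t≤ε/2)))
      (*-nonNeg (*-nonNeg (*-nonNeg (*-nonNeg 0≤R 0≤R) 0≤t) 0≤t) (p≤q⇒0≤q-p Λ≤1)))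
      (*-nonNeg (*-nonNeg 0≤Rt 0≤t) 0≤ε)

-- Choice of t and δ

record Parameters (R ε : ℚ) : Set where
  field
    t δ     : ℚ
    0<t     : 0ℚ < t
    t<1     : t < 1ℚ
    t≤ε     : t ≤ℚ ε
    R²t≤ε/2 : R * R * t ≤ℚ ½ * ε
    0<δ     : 0ℚ < δ
    δ-small : δ * (1ℚ + t * R * (1ℚ + R * t)) ≤ℚ ½ * (t * ε)

parameters : ∀ {R ε} → 0ℚ ≤ℚ R → 0ℚ < ε → ε ≤ℚ 1ℚ → Parameters R ε
parameters {R} {ε} 0≤R 0<ε ε≤1 = record
  { t = t ; δ = δ ; 0<t = 0<t ; t<1 = t<1 ; t≤ε = ≤-trans t≤ε/2 ε/2≤ε
  ; R²t≤ε/2 = subst (R * R * t ≤ℚ_) (sym ε/2≡t+R²t) (q≤p+q 0≤t)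
  ; 0<δ = 0<δ ; δ-small = ≤-reflexive δD≡tε/2
  }
  where
  open PositiveQuotient (positive-quotient (0<1+p (*-nonNeg 0≤R 0≤R)) (*-pos 0<½ 0<ε))
    renaming (quotient to t; 0<quotient to 0<t; quotient*a≡b to t[1+R²]≡ε/2)
  0≤t : 0ℚ ≤ℚ t
  0≤t = <⇒≤ 0<t
  open PositiveQuotient (positive-quotient (0<1+p (*-nonNeg (*-nonNeg 0≤t 0≤R) (0≤1+p (*-nonNeg 0≤R 0≤t))))
                                           (*-pos 0<½ (*-pos 0<t 0<ε)))
    renaming (quotient to δ; 0<quotient to 0<δ; quotient*a≡b to δD≡tε/2)

  ε/2≡t+R²t : ½ * ε ≡ t + R * R * t
  ε/2≡t+R²t = trans (sym t[1+R²]≡ε/2) (expand t (R * R))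
    where
    expand : ∀ t s → t * (1ℚ + s) ≡ t + s * t
    expand = RingSolver.solve-∀ ℚ-ring
  t≤ε/2 : t ≤ℚ ½ * ε
  t≤ε/2 = subst (t ≤ℚ_) (sym ε/2≡t+R²t) (p≤p+q (*-nonNeg (*-nonNeg 0≤R 0≤R) 0≤t))
  ε/2≤ε : ½ * ε ≤ℚ ε
  ε/2≤ε = subst (½ * ε ≤ℚ_) (halves ε) (p≤p+q (*-nonNeg (<⇒≤ 0<½) (<⇒≤ 0<ε)))
    where
    halves : ∀ ε → ½ * ε + ½ * ε ≡ ε
    halves = RingSolver.solve-∀ ℚ-ring
  t<1 : t < 1ℚ
  t<1 = ≤-<-trans (≤-trans t≤ε/2 (*-monoˡ-≤-0≤ (<⇒≤ 0<½) ε≤1)) ½<1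

near-optimal⇒link-bound : ∀ {r ε} (P : Parameters (ℕ→ℚ r) ε) → let open Parameters P in
  ∀ {n} (F : List (Subset n)) → IsRGraph r F → (u : Fin n) (μ : Fin n → ℚ) → IsDist μ →
  ((ν : Fin n → ℚ) → IsDist ν → lag F ν - δ ≤ℚ lag F μ) → ε ≤ℚ μ u →
  (ν : Fin n → ℚ) → IsDist ν → ℕ→ℚ r * lag F ν - ε ≤ℚ lagLink F μ u
near-optimal⇒link-bound {r} P F (F! , uniform) u μ μ-dist@(μ≥0 , Σμ≡1) near-optimal ε≤μu ν ν-dist =
  link-lower-bound (ℕ→ℚ-nonNeg r) 0<t (≤-trans (<⇒≤ 0<t) t≤ε) lag≤1
    (perturbation-bound F uniform u μ μ-dist near-optimal (<⇒≤ 0<t) t<1 (≤-trans t≤ε ε≤μu))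
    (p-r≤q⇒p≤q+r (near-optimal ν ν-dist)) R²t≤ε/2 δ-small
  where
  open Parameters P
  lag≤1 : lag F μ ≤ℚ 1ℚ
  lag≤1 = subst (lag F μ ≤ℚ_) (trans (cong (_^ r) Σμ≡1) (^-zeroˡ r)) (lag≤sum^r r F F! uniform μ≥0)

-- The argument works for every r.
lemma4p4 : (r : ℕ) → 2 ≤ r → (ε : ℚ) → 0ℚ < ε →
    ∃[ δ ] (0ℚ < δ ×
      ((n : ℕ) (F : List (Subset n)) → IsRGraph r F → (u : Fin n) →
       (μ : Fin n → ℚ) → IsDist μ →
       ((ν : Fin n → ℚ) → IsDist ν → (lag F ν - δ) ≤ℚ lag F μ) →
       ε ≤ℚ μ u →
       ((ν : Fin n → ℚ) → IsDist ν → (ℕ→ℚ r * lag F ν - ε) ≤ℚ lagLink F μ u)))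
lemma4p4 r _ ε 0<ε = δ , 0<δ , λ n F F-graph u μ μ-dist near-optimal ε≤μu ν ν-dist →
  ≤-trans (+-monoʳ-≤ (ℕ→ℚ r * lag F ν) (neg-antimono-≤ e≤ε))
          (near-optimal⇒link-bound P F F-graph u μ μ-dist near-optimal (≤-trans e≤ε ε≤μu) ν ν-dist)
  where
  e : ℚ
  e = ε ⊓ 1ℚ
  e≤ε : e ≤ℚ ε
  e≤ε = p⊓q≤p ε 1ℚ
  0<e : 0ℚ < e
  0<e = [ (λ e≡ε → subst (0ℚ <_) (sym e≡ε) 0<ε)
        , (λ e≡1 → subst (0ℚ <_) (sym e≡1) (positive⁻¹ 1ℚ)) ]′ (⊓-sel ε 1ℚ)
  P : Parameters (ℕ→ℚ r) e
  P = parameters (ℕ→ℚ-nonNeg r) 0<e (p⊓q≤q ε 1ℚ)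
  open Parameters P using (δ; 0<δ)
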